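{- Let $k$ be even, $1\le s\le k-1$, $m$ a positive integer, $n=m(k-s)\ge 2k-s$, and let $G$ be the $k$-uniform $s$-cycle with $n$ vertices and $m$ edges: vertex set $\mathbb Z_n$ and edges $e_j=\{j(k-s)+1,\dots,j(k-s)+k\}$ (mod $n$), $j=0,\dots,m-1$. Assume there is an integer $q$ with $k=q(k-s)$, and write $q=2^{t_0}(2l_0+1)$ with nonnegative integers $t_0,l_0$. Then $G$ is odd-bipartite if and only if $m$ is a multiple of $2^{t_0}$.
   Context: A $k$-uniform hypergraph $G=(V,E)$ with $k$ even is odd-bipartite if either $E=\emptyset$ or there is a partition $V=V_1\cup V_2$ with $V_1,V_2\ne\emptyset$ such that every edge meets $V_1$ in an odd number of vertices. -}

module Defs where

open import Data.Nat using (ℕ; zero; suc; _+_; _*_; _∸_; _^_; _%_; NonZero)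
open import Data.Nat.DivMod using (m%n<n)
open import Data.Nat.Divisibility using (_∣_)
open import Relation.Nullary using (¬_)
open import Data.Fin using (Fin; fromℕ<; toℕ)
open import Data.Fin.Subset using (Subset; _∩_; ∣_∣; Nonempty; ∁; ⋃)
open import Data.List using (List; map; upTo)
open import Data.Product using (Σ; ∃; _×_)
open import Data.Sum using (_⊎_)
open import Relation.Binary.PropositionalEquality using (_≡_)

Evenℕ : ℕ → Set
Evenℕ x = 2 ∣ x

Oddℕ : ℕ → Set
Oddℕ x = ¬ (2 ∣ x)

record Hypergraph (n : ℕ) : Set where
  field
    m     : ℕ
    edge  : Fin m → Subset n

open Hypergraph public

Uniform : ∀ {n} → ℕ → Hypergraph n → Set
Uniform k G = ∀ j → ∣ edge G j ∣ ≡ k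

EdgeSetEmpty : ∀ {n} → Hypergraph n → Set
EdgeSetEmpty G = Fin (m G) → Data.Empty.⊥
  where import Data.Empty

OddBipartite : ∀ {n} → Hypergraph n → Set
OddBipartite {n} G =
  EdgeSetEmpty G ⊎
  (Σ (Subset n) λ V₁ → Nonempty V₁ × Nonempty (∁ V₁) ×
     (∀ j → Oddℕ ∣ edge G j ∩ V₁ ∣))

mod : (n : ℕ) .{{_ : NonZero n}} → ℕ → Fin n
mod n x = fromℕ< (m%n<n x n)

fromList : ∀ {n} → List (Fin n) → Subset n
fromList xs = ⋃ (map Data.Fin.Subset.⁅_⁆ xs)

sCycle : (k s m n : ℕ) .{{_ : NonZero n}} → Hypergraph n
sCycle k s m' n = record
  { m    = m'
  ; edge = λ j → fromList (map (λ i → mod n (toℕ j * (k ∸ s) + suc i)) (upTo k))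
  }

-- Write d = k − s, so that k = q·d and edge j consists of the q consecutive
-- blocks j, …, j+q−1 of d vertices each.  If V₁ meets every edge oddly, let
-- y j be the parity of |block j ∩ V₁|.  Comparing edges j and j+1 shows that y
-- has period q, and it has period m because the vertex set has n = m·d
-- elements; hence y has period g = gcd q m.  The first edge then has parity
-- (q/g)·(y 0 + ⋯ + y (g−1)), so q/g is odd and 2^t₀ ∣ q forces 2^t₀ ∣ g ∣ m.
-- Conversely, if 2^t₀ ∣ m then D = 2^t₀·d divides n and k = (2l₀+1)·D, so the
-- multiples of D meet each edge, a run of k consecutive residues, in exactly
-- 2l₀+1 vertices; they form a proper subset because D ≥ 2 when k is even.
module Submission where

open import Defs
open import Data.Nat using (ℕ; _+_; _*_; _∸_; _^_; _≤_; _<_; NonZero)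
open import Data.Nat.Divisibility using (_∣_)
open import Data.Product using (_×_)
open import Function.Bundles using (_⇔_)
open import Relation.Binary.PropositionalEquality using (_≡_)

open import Data.Bool using (true; false; if_then_else_)
open import Data.Empty using (⊥-elim)
open import Data.Fin using (Fin; zero; suc; toℕ; fromℕ<)
open import Data.Fin.Properties using (toℕ-fromℕ<; toℕ-injective)
open import Data.Fin.Subset using (Subset; ⁅_⁆; _∪_; _∩_; ∣_∣; _∈_; _∉_)
open import Data.Fin.Subset.Properties using (∉⊥; ∣⊥∣≡0; ∩-zeroˡ; x∈p∪q⁻; x∈⁅y⁆⇒x≡y; x∉p⇒x∈∁p; ∪-identityˡ)
open import Data.List using ([]; _∷_; map; applyUpTo)
open import Data.List.Membership.Propositional using () renaming (_∈_ to _∈ₗ_)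
open import Data.List.Properties using (map-applyUpTo)
open import Data.List.Relation.Unary.All as All using ()
open import Data.List.Relation.Unary.Any using (here; there)
open import Data.List.Relation.Unary.Unique.Propositional using (Unique; []; _∷_)
open import Data.List.Relation.Unary.Unique.Propositional.Properties using (applyUpTo⁺₁)
open import Data.Nat using (zero; suc; pred; >-nonZero; >-nonZero⁻¹; z≤n; s≤s; z<s; s<s; _≡ᵇ_)
open import Data.Nat.DivMod
open import Data.Nat.Divisibility using (divides; ∣-trans; ∣⇒≤; m%n≡0⇒n∣m; n∣m⇒m%n≡0;
  ∣m⇒∣m*n; ∣m+n∣m⇒∣n; ∣1⇒≡1; m*n∣⇒m∣; *-monoʳ-∣; *-cancelˡ-∣; 1∣_)
open import Data.Nat.GCD using (gcd; gcd[m,n]∣m; gcd[m,n]∣n; gcd-GCD; module Bézout)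
open import Data.Nat.ListAction using (sum)
open import Data.Nat.Primality using (euclidsLemma; prime[2])
open import Data.Nat.Properties
open import Data.Nat.Tactic.RingSolver using (solve-∀)
open import Data.Product using (_,_)
open import Data.Sum using (inj₁; inj₂)
open import Data.Vec using ([]; _∷_; lookup; tabulate; here; there)
open import Data.Vec.Properties using (lookup∘tabulate; lookup⇒[]=; []=⇒lookup)
open import Function using (_∘_; id)
open import Function.Bundles using (mk⇔)
open import Relation.Nullary using (contradiction)
open import Relation.Binary.PropositionalEquality using (refl; sym; trans; cong; cong₂; subst; _≢_; module ≡-Reasoning)

open ≡-Reasoning

∑< : ℕ → (ℕ → ℕ) → ℕ
∑< L f = sum (applyUpTo f L)

syntax ∑< L (λ i → e) = ∑[ i < L ] e

∑-cong : ∀ L {f g : ℕ → ℕ} → (∀ i → i < L → f i ≡ g i) → ∑< L f ≡ ∑< L g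
∑-cong zero    f≗g = refl
∑-cong (suc L) f≗g = cong₂ _+_ (f≗g 0 z<s) (∑-cong L (λ i i<L → f≗g (suc i) (s<s i<L)))

∑-+ : ∀ L₁ L₂ f → ∑< (L₁ + L₂) f ≡ ∑< L₁ f + ∑[ i < L₂ ] f (L₁ + i)
∑-+ zero     L₂ f = refl
∑-+ (suc L₁) L₂ f = trans (cong (f 0 +_) (∑-+ L₁ L₂ (f ∘ suc))) (sym (+-assoc (f 0) _ _))

∑-suc : ∀ L f → ∑< (suc L) f ≡ ∑< L f + f L
∑-suc L f = begin
  ∑< (suc L) f                   ≡⟨ cong (λ L′ → ∑< L′ f) (+-comm 1 L) ⟩
  ∑< (L + 1) f                   ≡⟨ ∑-+ L 1 f ⟩
  ∑< L f + (f (L + 0) + 0)       ≡⟨ cong (∑< L f +_) (trans (+-identityʳ _) (cong f (+-identityʳ L))) ⟩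
  ∑< L f + f L                   ∎

∑-const : ∀ L c → ∑[ _ < L ] c ≡ L * c
∑-const zero    c = refl
∑-const (suc L) c = cong (c +_) (∑-const L c)

∑-* : ∀ c d f → ∑< (c * d) f ≡ ∑[ b < c ] ∑[ i < d ] f (b * d + i)
∑-* zero    d f = refl
∑-* (suc c) d f = begin
  ∑< (d + c * d) f                                    ≡⟨ ∑-+ d (c * d) f ⟩
  ∑< d f + ∑[ i < c * d ] f (d + i)                   ≡⟨ cong (∑< d f +_) (∑-* c d (λ i → f (d + i))) ⟩
  ∑< d f + ∑[ b < c ] ∑[ i < d ] f (d + (b * d + i))  ≡⟨ cong (∑< d f +_) (∑-cong c λ b _ →
                                                           ∑-cong d λ i _ → cong f (sym (+-assoc d (b * d) i))) ⟩
  ∑< d f + ∑[ b < c ] ∑[ i < d ] f (d + b * d + i)    ∎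

module _ {o : ℕ} .{{_ : NonZero o}} where

  %-cong-+ : ∀ {a a′ b b′} → a % o ≡ a′ % o → b % o ≡ b′ % o → (a + b) % o ≡ (a′ + b′) % o
  %-cong-+ {a} {a′} {b} {b′} a≡a′ b≡b′ = begin
    (a + b) % o               ≡⟨ %-distribˡ-+ a b o ⟩
    (a % o + b % o) % o       ≡⟨ cong₂ (λ x y → (x + y) % o) a≡a′ b≡b′ ⟩
    (a′ % o + b′ % o) % o     ≡⟨ %-distribˡ-+ a′ b′ o ⟨
    (a′ + b′) % o             ∎

  -- Adding (o − 1)·c undoes the addition of c modulo o.
  %-cancelʳ-+ : ∀ a b c → (a + c) % o ≡ (b + c) % o → a % o ≡ b % o
  %-cancelʳ-+ a b c eq = begin
    a % o                     ≡⟨ [m+kn]%n≡m%n a c o ⟨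
    (a + c * o) % o           ≡⟨ cong (_% o) (undo a) ⟩
    (a + c + c * pred o) % o  ≡⟨ %-cong-+ eq refl ⟩
    (b + c + c * pred o) % o  ≡⟨ cong (_% o) (undo b) ⟨
    (b + c * o) % o           ≡⟨ [m+kn]%n≡m%n b c o ⟩
    b % o                     ∎
    where
    undo : ∀ x → x + c * o ≡ x + c + c * pred o
    undo x = begin
      x + c * o                ≡⟨ cong (λ o′ → x + c * o′) (suc-pred o) ⟨
      x + c * suc (pred o)     ≡⟨ cong (x +_) (*-suc c (pred o)) ⟩
      x + (c + c * pred o)     ≡⟨ +-assoc x c (c * pred o) ⟨
      x + c + c * pred o       ∎

  ∑-% : ∀ L f → ∑< L f % o ≡ ∑[ i < L ] (f i % o) % o
  ∑-% zero    f = refl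
  ∑-% (suc L) f = %-cong-+ (sym (m%n%n≡m%n (f 0) o)) (∑-% L (f ∘ suc))

Periodic : ℕ → (ℕ → ℕ) → Set
Periodic p f = ∀ x → f (x + p) ≡ f x

periodic-* : ∀ {p f} → Periodic p f → ∀ c → Periodic (c * p) f
periodic-* {p} {f} per zero    x = cong f (+-identityʳ x)
periodic-* {p} {f} per (suc c) x = begin
  f (x + (p + c * p))  ≡⟨ cong f (trans (cong (x +_) (+-comm p (c * p))) (sym (+-assoc x (c * p) p))) ⟩
  f (x + c * p + p)    ≡⟨ per (x + c * p) ⟩
  f (x + c * p)        ≡⟨ periodic-* per c x ⟩
  f x                  ∎

periodic-gcd : ∀ {p q f} → Periodic p f → Periodic q f → Periodic (gcd p q) f
periodic-gcd {p} {q} {f} per-p per-q x with Bézout.identity (gcd-GCD p q)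
... | Bézout.+- a b g+bq≡ap = begin
  f (x + gcd p q)            ≡⟨ periodic-* per-q b (x + gcd p q) ⟨
  f (x + gcd p q + b * q)    ≡⟨ cong f (trans (+-assoc x _ _) (cong (x +_) g+bq≡ap)) ⟩
  f (x + a * p)              ≡⟨ periodic-* per-p a x ⟩
  f x                        ∎
... | Bézout.-+ a b g+ap≡bq = begin
  f (x + gcd p q)            ≡⟨ periodic-* per-p a (x + gcd p q) ⟨
  f (x + gcd p q + a * p)    ≡⟨ cong f (trans (+-assoc x _ _) (cong (x +_) g+ap≡bq)) ⟩
  f (x + b * q)              ≡⟨ periodic-* per-q b x ⟩
  f x                        ∎

periodic-% : ∀ {p f} .{{_ : NonZero p}} → Periodic p f → ∀ x → f x ≡ f (x % p)
periodic-% {p} {f} per x = trans (cong f (m≡m%n+[m/n]*n x p)) (periodic-* per (x / p) (x % p))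

∑-shift-periodic : ∀ {D h} → Periodic D h → ∀ a → ∑[ i < D ] h (a + i) ≡ ∑< D h
∑-shift-periodic         per zero    = refl
∑-shift-periodic {D} {h} per (suc a) = trans (+-cancelˡ-≡ (h a) _ _ one-step-later) (∑-shift-periodic per a)
  where
  one-step-later : h a + ∑[ i < D ] h (suc a + i) ≡ h a + ∑[ i < D ] h (a + i)
  one-step-later = begin
    h a + ∑[ i < D ] h (suc a + i)    ≡⟨ cong₂ _+_ (cong h (+-identityʳ a)) (∑-cong D λ i _ → cong h (+-suc a i)) ⟨
    ∑[ i < suc D ] h (a + i)          ≡⟨ ∑-suc D (λ i → h (a + i)) ⟩
    ∑[ i < D ] h (a + i) + h (a + D)  ≡⟨ cong (∑[ i < D ] h (a + i) +_) (per a) ⟩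
    ∑[ i < D ] h (a + i) + h a        ≡⟨ +-comm _ (h a) ⟩
    h a + ∑[ i < D ] h (a + i)        ∎

∑-periodic : ∀ {D h} → Periodic D h → ∀ c a → ∑[ i < c * D ] h (a + i) ≡ c * ∑< D h
∑-periodic {D} {h} per c a = begin
  ∑[ i < c * D ] h (a + i)                   ≡⟨ ∑-* c D (λ i → h (a + i)) ⟩
  ∑[ b < c ] ∑[ i < D ] h (a + (b * D + i))  ≡⟨ ∑-cong c (λ b _ → trans
                                                  (∑-cong D λ i _ → cong h (sym (+-assoc a (b * D) i)))
                                                  (∑-shift-periodic per (a + b * D))) ⟩
  ∑[ _ < c ] ∑< D h                          ≡⟨ ∑-const c (∑< D h) ⟩
  c * ∑< D h                                 ∎

2∣2*l : ∀ l → 2 ∣ 2 * l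
2∣2*l l = divides l (*-comm 2 l)

odd[2*l+1] : ∀ l → Oddℕ (2 * l + 1)
odd[2*l+1] l 2∣2l+1 with ∣1⇒≡1 (∣m+n∣m⇒∣n 2∣2l+1 (2∣2*l l))
... | ()

odd⇒%2≡1 : ∀ x → Oddℕ x → x % 2 ≡ 1
odd⇒%2≡1 x odd with x % 2 | m%n<n x 2 | m%n≡0⇒n∣m x 2
... | zero        | _             | 2∣x = contradiction (2∣x refl) odd
... | suc zero    | _             | _   = refl
... | suc (suc _) | s≤s (s≤s ()) | _

odd-resp-%2 : ∀ {x y} → x % 2 ≡ y % 2 → Oddℕ x → Oddℕ y
odd-resp-%2 {x} {y} x≡y odd 2∣y = odd (m%n≡0⇒n∣m x 2 (trans x≡y (n∣m⇒m%n≡0 y 2 2∣y)))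

odd[r*x]⇒odd[r] : ∀ r x → Oddℕ (r * x) → Oddℕ r
odd[r*x]⇒odd[r] r x odd 2∣r = odd (∣m⇒∣m*n x 2∣r)

2^t∣r*g⇒2^t∣g : ∀ t {r g} → Oddℕ r → 2 ^ t ∣ r * g → 2 ^ t ∣ g
2^t∣r*g⇒2^t∣g zero    {g = g} _     _       = 1∣ g
2^t∣r*g⇒2^t∣g (suc t) {r} {g} r-odd 2^t+1∣rg
  with euclidsLemma r g prime[2] (m*n∣⇒m∣ 2 (2 ^ t) 2^t+1∣rg)
... | inj₁ 2∣r                  = contradiction 2∣r r-odd
... | inj₂ (divides g′ g≡g′*2) = subst (2 ^ suc t ∣_) (sym g≡2g′) (*-monoʳ-∣ 2 2^t∣g′)
  where
  g≡2g′ : g ≡ 2 * g′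
  g≡2g′ = trans g≡g′*2 (*-comm g′ 2)
  rg≡2[rg′] : r * g ≡ 2 * (r * g′)
  rg≡2[rg′] = trans (cong (r *_) g≡2g′) (swap r g′)
    where
    swap : ∀ r g′ → r * (2 * g′) ≡ 2 * (r * g′)
    swap = solve-∀
  2^t∣g′ : 2 ^ t ∣ g′
  2^t∣g′ = 2^t∣r*g⇒2^t∣g t r-odd (*-cancelˡ-∣ 2 (subst (2 ^ suc t ∣_) rg≡2[rg′] 2^t+1∣rg))

-- Windows of a periodic sequence

block : (ℕ → ℕ) → ℕ → ℕ → ℕ
block F d j = ∑[ i < d ] F (j * d + i)

window : (ℕ → ℕ) → ℕ → ℕ → ℕ → ℕ
window F d q j = ∑[ i < q * d ] F (j * d + i)

∑-blocks-periodic : ∀ {m d F} → Periodic (m * d) F → ∀ L → Periodic m (λ j → ∑[ i < L ] F (j * d + i))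
∑-blocks-periodic {m} {d} {F} per L j = ∑-cong L λ i _ → trans (cong F (shift j m d i)) (per (j * d + i))
  where
  shift : ∀ j m d i → (j + m) * d + i ≡ j * d + i + m * d
  shift = solve-∀

window≡∑block : ∀ F d q → window F d q 0 ≡ ∑< q (block F d)
window≡∑block F d q = ∑-* q d F

window-slide : ∀ F d q j → window F d q j + block F d (j + q) ≡ block F d j + window F d q (suc j)
window-slide F d q j = begin
  ∑< (q * d) G + block F d (j + q)       ≡⟨ cong (∑< (q * d) G +_) (∑-cong d λ i _ → cong F later) ⟩
  ∑< (q * d) G + ∑[ i < d ] G (q * d + i) ≡⟨ ∑-+ (q * d) d G ⟨
  ∑< (q * d + d) G                        ≡⟨ cong (λ L → ∑< L G) (+-comm (q * d) d) ⟩
  ∑< (d + q * d) G                        ≡⟨ ∑-+ d (q * d) G ⟩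
  block F d j + ∑[ i < q * d ] G (d + i)  ≡⟨ cong (block F d j +_) (∑-cong (q * d) λ i _ → cong F (sym next)) ⟩
  block F d j + window F d q (suc j)      ∎
  where
  G : ℕ → ℕ
  G i = F (j * d + i)
  later : ∀ {i} → (j + q) * d + i ≡ j * d + (q * d + i)
  later {i} = trans (cong (_+ i) (*-distribʳ-+ d j q)) (+-assoc (j * d) (q * d) i)
  next : ∀ {i} → suc j * d + i ≡ j * d + (d + i)
  next {i} = trans (cong (_+ i) (+-comm d (j * d))) (+-assoc (j * d) d i)

module _ {o : ℕ} .{{_ : NonZero o}} where

  block%-periodic : ∀ F d q → (∀ j → window F d q j % o ≡ window F d q (suc j) % o) →
                    Periodic q (λ j → block F d j % o)
  block%-periodic F d q same j = %-cancelʳ-+ _ _ (window F d q j) (begin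
    (block F d (j + q) + window F d q j) % o     ≡⟨ cong (_% o) (+-comm _ (window F d q j)) ⟩
    (window F d q j + block F d (j + q)) % o     ≡⟨ cong (_% o) (window-slide F d q j) ⟩
    (block F d j + window F d q (suc j)) % o     ≡⟨ %-cong-+ {a = block F d j} refl (sym (same j)) ⟩
    (block F d j + window F d q j) % o           ∎)

odd-windows⇒odd-cofactor : ∀ {F d q m r} .{{_ : NonZero m}} → Periodic (m * d) F →
  (∀ j → j < m → Oddℕ (window F d q j)) → q ≡ r * gcd q m → Oddℕ r
odd-windows⇒odd-cofactor {F} {d} {q} {m} {r} per odd-below-m q≡rg =
  odd[r*x]⇒odd[r] r (∑< g y) (odd-resp-%2 parity-of-first-window (odd-window 0))
  where
  g = gcd q m
  y : ℕ → ℕ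
  y j = block F d j % 2
  odd-window : ∀ j → Oddℕ (window F d q j)
  odd-window j = subst Oddℕ (sym (periodic-% (∑-blocks-periodic per (q * d)) j)) (odd-below-m _ (m%n<n j m))
  y-periodic : Periodic g y
  y-periodic = periodic-gcd
    (block%-periodic F d q λ j → trans (odd⇒%2≡1 _ (odd-window j)) (sym (odd⇒%2≡1 _ (odd-window (suc j)))))
    (λ j → cong (_% 2) (∑-blocks-periodic per d j))
  parity-of-first-window : window F d q 0 % 2 ≡ r * ∑< g y % 2
  parity-of-first-window = begin
    window F d q 0 % 2       ≡⟨ cong (_% 2) (window≡∑block F d q) ⟩
    ∑< q (block F d) % 2     ≡⟨ ∑-% q (block F d) ⟩
    ∑< q y % 2               ≡⟨ cong (λ L → ∑< L y % 2) q≡rg ⟩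
    ∑< (r * g) y % 2         ≡⟨ cong (_% 2) (∑-periodic y-periodic r 0) ⟩
    r * ∑< g y % 2           ∎

χ : ∀ {n} → Subset n → Fin n → ℕ
χ p x = if lookup p x then 1 else 0

∣⁅x⁆∪p∩q∣ : ∀ {n} (x : Fin n) (p q : Subset n) → x ∉ p → ∣ (⁅ x ⁆ ∪ p) ∩ q ∣ ≡ χ q x + ∣ p ∩ q ∣
∣⁅x⁆∪p∩q∣ zero    (true ∷ p)  q           x∉p = contradiction here x∉p
∣⁅x⁆∪p∩q∣ zero    (false ∷ p) (true ∷ q)  _   = cong (λ r → suc ∣ r ∩ q ∣) (∪-identityˡ p)
∣⁅x⁆∪p∩q∣ zero    (false ∷ p) (false ∷ q) _   = cong (λ r → ∣ r ∩ q ∣) (∪-identityˡ p)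
∣⁅x⁆∪p∩q∣ (suc x) (true ∷ p)  (true ∷ q)  x∉p =
  trans (cong suc (∣⁅x⁆∪p∩q∣ x p q (x∉p ∘ there))) (sym (+-suc (χ q x) _))
∣⁅x⁆∪p∩q∣ (suc x) (true ∷ p)  (false ∷ q) x∉p = ∣⁅x⁆∪p∩q∣ x p q (x∉p ∘ there)
∣⁅x⁆∪p∩q∣ (suc x) (false ∷ p) (_ ∷ q)     x∉p = ∣⁅x⁆∪p∩q∣ x p q (x∉p ∘ there)

∈fromList⁻ : ∀ {n} {x : Fin n} xs → x ∈ fromList xs → x ∈ₗ xs
∈fromList⁻ []       x∈∅ = contradiction x∈∅ ∉⊥
∈fromList⁻ (y ∷ ys) x∈  with x∈p∪q⁻ ⁅ y ⁆ (fromList ys) x∈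
... | inj₁ x∈⁅y⁆ = here (x∈⁅y⁆⇒x≡y y x∈⁅y⁆)
... | inj₂ x∈ys  = there (∈fromList⁻ ys x∈ys)

∣fromList∩∣ : ∀ {n} (q : Subset n) {xs} → Unique xs → ∣ fromList xs ∩ q ∣ ≡ sum (map (χ q) xs)
∣fromList∩∣ {n} q []                   = trans (cong ∣_∣ (∩-zeroˡ q)) (∣⊥∣≡0 n)
∣fromList∩∣ q {x ∷ xs} (x∉xs ∷ unique) = begin
  ∣ (⁅ x ⁆ ∪ fromList xs) ∩ q ∣   ≡⟨ ∣⁅x⁆∪p∩q∣ x (fromList xs) q (λ x∈ → All.lookup x∉xs (∈fromList⁻ xs x∈) refl) ⟩
  χ q x + ∣ fromList xs ∩ q ∣     ≡⟨ cong (χ q x +_) (∣fromList∩∣ q unique) ⟩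
  χ q x + sum (map (χ q) xs)      ∎

%≡%⇒∣∸ : ∀ x y n .{{_ : NonZero n}} → x % n ≡ y % n → n ∣ y ∸ x
%≡%⇒∣∸ x y n x≡y = divides (y / n ∸ x / n) (begin
  y ∸ x                                      ≡⟨ cong₂ _∸_ (m≡m%n+[m/n]*n y n) (m≡m%n+[m/n]*n x n) ⟩
  (y % n + y / n * n) ∸ (x % n + x / n * n)  ≡⟨ cong (λ r → (y % n + y / n * n) ∸ (r + x / n * n)) x≡y ⟩
  (y % n + y / n * n) ∸ (y % n + x / n * n)  ≡⟨ [m+n]∸[m+o]≡n∸o (y % n) _ _ ⟩
  y / n * n ∸ x / n * n                      ≡⟨ *-distribʳ-∸ n (y / n) (x / n) ⟨
  (y / n ∸ x / n) * n                        ∎)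

x<y<x+n⇒x%n≢y%n : ∀ {x y n} .{{_ : NonZero n}} → x < y → y < x + n → x % n ≢ y % n
x<y<x+n⇒x%n≢y%n {x} {y} {n} x<y y<x+n x≡y = <⇒≱ (m<n+o⇒m∸n<o y x y<x+n) n≤y∸x
  where
  instance
    y∸x≢0 : NonZero (y ∸ x)
    y∸x≢0 = >-nonZero (m<n⇒0<n∸m x<y)
  n≤y∸x : n ≤ y ∸ x
  n≤y∸x = ∣⇒≤ (%≡%⇒∣∸ x y n x≡y)

consecutive-residues-unique : ∀ {n} .{{_ : NonZero n}} a {L} → L ≤ n →
                              Unique (applyUpTo (λ i → mod n (a + suc i)) L)
consecutive-residues-unique {n} a {L} L≤n = applyUpTo⁺₁ _ L distinct
  where
  distinct : ∀ {i j} → i < j → j < L → mod n (a + suc i) ≢ mod n (a + suc j)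
  distinct {i} {j} i<j j<L eq = x<y<x+n⇒x%n≢y%n (+-monoʳ-< a (s<s i<j)) y<x+n
    (trans (sym (toℕ-fromℕ< _)) (trans (cong toℕ eq) (toℕ-fromℕ< _)))
    where
    y<x+n : a + suc j < a + suc i + n
    y<x+n = subst (a + suc j <_) (sym (+-assoc a (suc i) n))
              (+-monoʳ-< a (s≤s (≤-trans (≤-trans j<L L≤n) (m≤n+m n i))))

mod-+n : ∀ {n} .{{_ : NonZero n}} x → mod n (x + n) ≡ mod n x
mod-+n {n} x = toℕ-injective (begin
  toℕ (mod n (x + n))  ≡⟨ toℕ-fromℕ< _ ⟩
  (x + n) % n          ≡⟨ [m+n]%n≡m%n x n ⟩
  x % n                ≡⟨ toℕ-fromℕ< _ ⟨
  toℕ (mod n x)        ∎)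

∣sCycle-edge∩∣ : ∀ {k s m n} .{{_ : NonZero n}} → k ≤ n → (p : Subset n) (j : Fin m) →
  ∣ edge (sCycle k s m n) j ∩ p ∣ ≡ ∑[ i < k ] χ p (mod n (toℕ j * (k ∸ s) + suc i))
∣sCycle-edge∩∣ {k} {s} {m} {n} k≤n p j = begin
  ∣ fromList (map vertex (applyUpTo id k)) ∩ p ∣ ≡⟨ cong (λ xs → ∣ fromList xs ∩ p ∣) (map-applyUpTo id vertex k) ⟩
  ∣ fromList (applyUpTo vertex k) ∩ p ∣         ≡⟨ ∣fromList∩∣ p (consecutive-residues-unique (toℕ j * (k ∸ s)) k≤n) ⟩
  sum (map (χ p) (applyUpTo vertex k))          ≡⟨ cong sum (map-applyUpTo vertex (χ p) k) ⟩
  ∑< k (χ p ∘ vertex)                           ∎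
  where
  vertex : ℕ → Fin n
  vertex i = mod n (toℕ j * (k ∸ s) + suc i)

oddBipartite⇒2^t∣m : ∀ {k s m n q t} .{{_ : NonZero n}} → k ≤ n → 1 ≤ m →
  n ≡ m * (k ∸ s) → k ≡ q * (k ∸ s) → 2 ^ t ∣ q → OddBipartite (sCycle k s m n) → 2 ^ t ∣ m
oddBipartite⇒2^t∣m _ 1≤m _ _ _ (inj₁ no-edges) = ⊥-elim (no-edges (fromℕ< 1≤m))
oddBipartite⇒2^t∣m {k} {s} {m} {n} {q} {t} k≤n 1≤m n≡md k≡qd 2^t∣q (inj₂ (V , _ , _ , odd-edges))
  with gcd[m,n]∣m q m
... | divides r q≡rg = ∣-trans (2^t∣r*g⇒2^t∣g t r-odd (subst (2 ^ t ∣_) q≡rg 2^t∣q)) (gcd[m,n]∣n q m)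
  where
  instance
    m≢0 : NonZero m
    m≢0 = >-nonZero 1≤m
  d = k ∸ s
  F : ℕ → ℕ
  F v = χ V (mod n (suc v))
  F-periodic : Periodic (m * d) F
  F-periodic v = cong (χ V) (trans (cong (λ x → mod n (suc v + x)) (sym n≡md)) (mod-+n (suc v)))
  edge≡window : ∀ {j} (j<m : j < m) → ∣ edge (sCycle k s m n) (fromℕ< j<m) ∩ V ∣ ≡ window F d q j
  edge≡window {j} j<m = begin
    ∣ edge (sCycle k s m n) (fromℕ< j<m) ∩ V ∣            ≡⟨ ∣sCycle-edge∩∣ {s = s} k≤n V (fromℕ< j<m) ⟩
    ∑[ i < k ] χ V (mod n (toℕ (fromℕ< j<m) * d + suc i)) ≡⟨ ∑-cong k (λ i _ → cong (χ V ∘ mod n)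
                                                               (trans (cong (λ x → x * d + suc i) (toℕ-fromℕ< j<m)) (+-suc _ i))) ⟩
    ∑[ i < k ] F (j * d + i)                               ≡⟨ cong (λ L → ∑[ i < L ] F (j * d + i)) k≡qd ⟩
    window F d q j                                         ∎
  r-odd : Oddℕ r
  r-odd = odd-windows⇒odd-cofactor {F} {d} {q} {m} {r} F-periodic
    (λ j j<m → subst Oddℕ (edge≡window j<m) (odd-edges (fromℕ< j<m))) q≡rg

-- The odd-bipartition by multiples of D

multiplesOf : ∀ n D .{{_ : NonZero D}} → Subset n
multiplesOf n D = tabulate (λ x → toℕ x % D ≡ᵇ 0)

𝟙-multiple : ∀ D .{{_ : NonZero D}} → ℕ → ℕ
𝟙-multiple D v = if v % D ≡ᵇ 0 then 1 else 0

∑-𝟙-multiple : ∀ D .{{_ : NonZero D}} → ∑< D (𝟙-multiple D) ≡ 1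
∑-𝟙-multiple (suc D′) = cong (1 +_) (begin
  ∑[ i < D′ ] 𝟙-multiple (suc D′) (suc i) ≡⟨ ∑-cong D′ (λ i i<D′ →
                                               cong (λ r → if r ≡ᵇ 0 then 1 else 0) (m<n⇒m%n≡m (s<s i<D′))) ⟩
  ∑[ _ < D′ ] 0                            ≡⟨ ∑-const D′ 0 ⟩
  D′ * 0                                   ≡⟨ *-zeroʳ D′ ⟩
  0                                        ∎)

module _ {D : ℕ} .{{_ : NonZero D}} where

  χ-multiplesOf : ∀ {n} .{{_ : NonZero n}} → D ∣ n → ∀ v → χ (multiplesOf n D) (mod n v) ≡ 𝟙-multiple D v
  χ-multiplesOf {n} D∣n v = cong (λ b → if b then 1 else 0) (begin
    lookup (multiplesOf n D) (mod n v)  ≡⟨ lookup∘tabulate _ (mod n v) ⟩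
    toℕ (mod n v) % D ≡ᵇ 0              ≡⟨ cong (λ x → x % D ≡ᵇ 0) (toℕ-fromℕ< _) ⟩
    v % n % D ≡ᵇ 0                      ≡⟨ cong (_≡ᵇ 0) (m∣n⇒o%n%m≡o%m D n v D∣n) ⟩
    v % D ≡ᵇ 0                          ∎)

  𝟙-multiple-periodic : Periodic D (𝟙-multiple D)
  𝟙-multiple-periodic x = cong (λ r → if r ≡ᵇ 0 then 1 else 0) ([m+n]%n≡m%n x D)

  multiples-in-run : ∀ c a → ∑[ i < c * D ] 𝟙-multiple D (a + i) ≡ c
  multiples-in-run c a = begin
    ∑[ i < c * D ] 𝟙-multiple D (a + i)  ≡⟨ ∑-periodic 𝟙-multiple-periodic c a ⟩
    c * ∑< D (𝟙-multiple D)              ≡⟨ cong (c *_) (∑-𝟙-multiple D) ⟩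
    c * 1                                ≡⟨ *-identityʳ c ⟩
    c                                    ∎

  0∈multiplesOf : ∀ {n} (0<n : 0 < n) → fromℕ< 0<n ∈ multiplesOf n D
  0∈multiplesOf {n} 0<n = lookup⇒[]= _ (multiplesOf n D) (begin
    lookup (multiplesOf n D) (fromℕ< 0<n)  ≡⟨ lookup∘tabulate _ (fromℕ< 0<n) ⟩
    toℕ (fromℕ< 0<n) % D ≡ᵇ 0              ≡⟨ cong (λ x → x % D ≡ᵇ 0) (toℕ-fromℕ< 0<n) ⟩
    0 % D ≡ᵇ 0                             ≡⟨ cong (_≡ᵇ 0) (m<n⇒m%n≡m (>-nonZero⁻¹ D)) ⟩
    true                                   ∎)

  1∉multiplesOf : ∀ {n} (1<n : 1 < n) → 2 ≤ D → fromℕ< 1<n ∉ multiplesOf n D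
  1∉multiplesOf {n} 1<n 2≤D 1∈ with () ← begin
    false                                  ≡⟨ cong (_≡ᵇ 0) (m<n⇒m%n≡m 2≤D) ⟨
    1 % D ≡ᵇ 0                             ≡⟨ cong (λ x → x % D ≡ᵇ 0) (toℕ-fromℕ< 1<n) ⟨
    toℕ (fromℕ< 1<n) % D ≡ᵇ 0              ≡⟨ lookup∘tabulate _ (fromℕ< 1<n) ⟨
    lookup (multiplesOf n D) (fromℕ< 1<n)  ≡⟨ []=⇒lookup 1∈ ⟩
    true                                   ∎

  multiplesOf-meets-edges-oddly : ∀ {k s m n l} .{{_ : NonZero n}} → k ≤ n → D ∣ n → k ≡ (2 * l + 1) * D →
    ∀ j → Oddℕ ∣ edge (sCycle k s m n) j ∩ multiplesOf n D ∣
  multiplesOf-meets-edges-oddly {k} {s} {m} {n} {l} k≤n D∣n k≡[2l+1]D j =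
    subst Oddℕ (sym count) (odd[2*l+1] l)
    where
    a = toℕ j * (k ∸ s)
    count : ∣ edge (sCycle k s m n) j ∩ multiplesOf n D ∣ ≡ 2 * l + 1
    count = begin
      ∣ edge (sCycle k s m n) j ∩ multiplesOf n D ∣       ≡⟨ ∣sCycle-edge∩∣ {s = s} k≤n (multiplesOf n D) j ⟩
      ∑[ i < k ] χ (multiplesOf n D) (mod n (a + suc i))  ≡⟨ ∑-cong k (λ i _ → trans (χ-multiplesOf D∣n (a + suc i))
                                                                                     (cong (𝟙-multiple D) (+-suc a i))) ⟩
      ∑[ i < k ] 𝟙-multiple D (suc a + i)                 ≡⟨ cong (λ L → ∑[ i < L ] 𝟙-multiple D (suc a + i)) k≡[2l+1]D ⟩
      ∑[ i < (2 * l + 1) * D ] 𝟙-multiple D (suc a + i)   ≡⟨ multiples-in-run (2 * l + 1) (suc a) ⟩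
      2 * l + 1                                           ∎

even≡odd*D⇒2≤D : ∀ {k l D} .{{_ : NonZero D}} → Evenℕ k → k ≡ (2 * l + 1) * D → 2 ≤ D
even≡odd*D⇒2≤D {l = l} {D = 1}           k-even k≡[2l+1] =
  contradiction (subst Evenℕ (trans k≡[2l+1] (*-identityʳ _)) k-even) (odd[2*l+1] l)
even≡odd*D⇒2≤D         {D = suc (suc _)} _      _        = s≤s (s≤s z≤n)

2^t∣m⇒oddBipartite : ∀ {k s m n q t l} .{{_ : NonZero n}} → Evenℕ k → 1 < n → k ≤ n → 1 ≤ k ∸ s →
  n ≡ m * (k ∸ s) → k ≡ q * (k ∸ s) → q ≡ 2 ^ t * (2 * l + 1) → 2 ^ t ∣ m → OddBipartite (sCycle k s m n)
2^t∣m⇒oddBipartite {k} {s} {m} {n} {q} {t} {l} k-even 1<n k≤n 1≤d n≡md k≡qd q≡2^t[2l+1] (divides c m≡c2^t) =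
  inj₂ ( multiplesOf n D
       , (fromℕ< 0<n , 0∈multiplesOf {D = D} 0<n)
       , (fromℕ< 1<n , x∉p⇒x∈∁p (1∉multiplesOf {D = D} 1<n (even≡odd*D⇒2≤D {l = l} k-even k≡[2l+1]D)))
       , multiplesOf-meets-edges-oddly {D = D} {s = s} {l = l} k≤n D∣n k≡[2l+1]D )
  where
  d = k ∸ s
  D = 2 ^ t * d
  instance
    D≢0 : NonZero D
    D≢0 = m*n≢0 (2 ^ t) d {{m^n≢0 2 t}} {{>-nonZero 1≤d}}
  0<n : 0 < n
  0<n = <-trans z<s 1<n
  D∣n : D ∣ n
  D∣n = divides c (trans n≡md (trans (cong (_* d) m≡c2^t) (*-assoc c (2 ^ t) d)))
  k≡[2l+1]D : k ≡ (2 * l + 1) * D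
  k≡[2l+1]D = trans k≡qd (trans (cong (_* d) q≡2^t[2l+1]) (rearrange (2 ^ t) (2 * l + 1) d))
    where
    rearrange : ∀ a b d → a * b * d ≡ b * (a * d)
    rearrange = solve-∀

k≤2k∸s : ∀ {k s} → s ≤ k → k ≤ 2 * k ∸ s
k≤2k∸s {k} {s} s≤k = subst (k ≤_) k+[k∸s]≡2k∸s (m≤m+n k (k ∸ s))
  where
  k+[k∸s]≡2k∸s : k + (k ∸ s) ≡ 2 * k ∸ s
  k+[k∸s]≡2k∸s = trans (sym (+-∸-assoc k s≤k)) (cong (λ x → k + x ∸ s) (sym (+-identityʳ k)))

theorem4p1 : (k s m n q t₀ l₀ : ℕ) .{{_ : NonZero n}} →
    Evenℕ k → 1 ≤ s → s < k → 1 ≤ m →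
    n ≡ m * (k ∸ s) → (2 * k) ∸ s ≤ n →
    k ≡ q * (k ∸ s) → q ≡ 2 ^ t₀ * (2 * l₀ + 1) →
    OddBipartite (sCycle k s m n) ⇔ (2 ^ t₀ ∣ m)
theorem4p1 k s m n q t₀ l₀ k-even 1≤s s<k 1≤m n≡md 2k∸s≤n k≡qd q≡2^t[2l+1] = mk⇔
  (oddBipartite⇒2^t∣m {s = s} {t = t₀} k≤n 1≤m n≡md k≡qd 2^t∣q)
  (2^t∣m⇒oddBipartite {s = s} {t = t₀} {l = l₀} k-even 1<n k≤n (m<n⇒0<n∸m s<k) n≡md k≡qd q≡2^t[2l+1])
  where
  k≤n : k ≤ n
  k≤n = ≤-trans (k≤2k∸s (<⇒≤ s<k)) 2k∸s≤n
  1<n : 1 < n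
  1<n = ≤-trans (s≤s 1≤s) (≤-trans s<k k≤n)
  2^t∣q : 2 ^ t₀ ∣ q
  2^t∣q = divides (2 * l₀ + 1) (trans q≡2^t[2l+1] (*-comm (2 ^ t₀) _))
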